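{- Let $n$ be a positive integer. Then $$\sum_{k=0}^{n-1}[4k-1]_{q^2}[4k-1]^2\frac{(q^{ -2};q^4)_k^4}{(q^4;q^4)_k^4}q^{4k} =(q^{2n}+1)^4[n]_{q^2}^4\frac{(q^{ -2};q^4)^4_{n}}{(q^4;q^4)_{n}^4} \biggl(2\cdot\frac{q^5+q^{4n+1}(q^{4n-2}-q^2-1)}{(q^2-1)^2}-q^{4n}\biggr).$$
   Context: For an integer $m$ (possibly negative), $[m]=[m]_q=(1-q^m)/(1-q)$ and $[m]_{q^2}=(1-q^{2m})/(1-q^2)$. The $q$-shifted factorial is $(a;q)_0=1$ and $(a;q)_k=(1-a)(1-aq)\cdots(1-aq^{k-1})$ for $k\ge1$. The identity is an identity of rational functions in $q$. -}

module Defs where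

open import Data.Nat using (ℕ; zero; suc)
open import Data.Integer using (ℤ; +_; -[1+_])
open import Data.Rational using (ℚ; 0ℚ; 1ℚ; _+_; _*_; _-_; 1/_; ≢-nonZero)
open import Data.Rational.Properties using (_≟_)
open import Relation.Nullary using (yes; no)

-- Total inverse on ℚ (inv 0 = 0); only used at nonzero arguments in the theorem.
inv : ℚ → ℚ
inv p with p ≟ 0ℚ
... | yes _ = 0ℚ
... | no p≢0 = 1/_ p {{≢-nonZero p≢0}}

infixl 7 _÷'_
_÷'_ : ℚ → ℚ → ℚ
x ÷' y = x * inv y

infixr 8 _^_
_^_ : ℚ → ℕ → ℚ
x ^ zero = 1ℚ
x ^ suc n = x * x ^ n

infixr 8 _^ℤ_
_^ℤ_ : ℚ → ℤ → ℚ
x ^ℤ (+ n) = x ^ n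
x ^ℤ -[1+ m ] = inv (x ^ suc m)

qint : ℚ → ℤ → ℚ
qint q m = (1ℚ - q ^ℤ m) ÷' (1ℚ - q)

qpoch : ℚ → ℚ → ℕ → ℚ
qpoch a q zero = 1ℚ
qpoch a q (suc k) = qpoch a q k * (1ℚ - a * q ^ k)

sumTo : ℕ → (ℕ → ℚ) → ℚ
sumTo zero f = 0ℚ
sumTo (suc n) f = sumTo n f + f n

-- Write x = q^(2n-1) and ρₙ = (q⁻²;q⁴)ₙ⁴ / (q⁴;q⁴)ₙ⁴.  Multiplied by (1 - q²)⁶, the
-- right-hand side at n becomes a polynomial F(x, ρₙ) and the n-th summand a polynomial
-- G(x, ρₙ) in q, x and ρₙ.  Passing from n to n + 1 replaces x by q²x, and
-- ρₙ₊₁ (1 - q⁶x²)⁴ = ρₙ (1 - x²)⁴; with this, F(q²x, ρₙ₊₁) = F(x, ρₙ) + G(x, ρₙ)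
-- is a polynomial identity, so the sum telescopes.  At n = 0 we have qx = 1, and
-- the factor (1 - q²x²)⁴ of F vanishes.

module Submission where

open import Defs
open import Data.Empty using (⊥-elim)
open import Data.Integer using (+_; -[1+_]) renaming (_*_ to _*ℤ_; _-_ to _-ℤ_; -_ to -ℤ_)
open import Data.Integer.Properties using (pos-*)
open import Data.Nat using (ℕ; zero; suc; NonZero)
import Data.Nat as ℕ
import Data.Nat.Properties as ℕₚ
open import Data.Rational using (ℚ; 0ℚ; 1ℚ; _+_; _*_; _-_; _≤_; nonNegative; nonPositive; ≢-nonZero)
open import Data.Rational.Properties
  using (_≟_; +-*-commutativeRing; *-comm; *-assoc; *-identityˡ; *-identityʳ; *-zeroˡ; *-zeroʳ
        ; *-distribˡ-+; *-inverseʳ; 1≢0; ≤-refl; ≤-total; ≤-antisym; +-mono-≤; +-identityʳ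
        ; nonNegative⁻¹; nonNeg*nonNeg⇒nonNeg; *-monoˡ-≤-nonPos)
open import Data.Sum using (inj₁; inj₂)
open import Relation.Binary.PropositionalEquality
open import Relation.Nullary using (yes; no; Dec)
open import Relation.Nullary.Decidable using (dec⇒maybe)
open import Tactic.RingSolver using (solve-∀)
open import Tactic.RingSolver.Core.AlmostCommutativeRing using (AlmostCommutativeRing; fromCommutativeRing)

open ≡-Reasoning

ℚ-ring : AlmostCommutativeRing _ _
ℚ-ring = fromCommutativeRing +-*-commutativeRing (λ p → dec⇒maybe (0ℚ ≟ p))

-- solve-∀ recognises only the solver's own power _^ʳ_, not Defs._^_, so the
-- polynomial identities below are stated with _^ʳ_ and linked to _^_ by ^≡^ʳ.
open AlmostCommutativeRing ℚ-ring using () renaming (_^_ to _^ʳ_)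

^≡^ʳ : ∀ x n → x ^ n ≡ x ^ʳ n
^≡^ʳ x zero          = refl
^≡^ʳ x (suc zero)    = *-identityʳ x
^≡^ʳ x (suc (suc n)) = trans (cong (x *_) (^≡^ʳ x (suc n))) (*-comm x (x ^ʳ suc n))

inv-inverseʳ : ∀ {p} → p ≢ 0ℚ → p * inv p ≡ 1ℚ
inv-inverseʳ {p} p≢0 with p ≟ 0ℚ
... | yes p≡0 = ⊥-elim (p≢0 p≡0)
... | no  p≢0 = *-inverseʳ p {{≢-nonZero p≢0}}

inv-inverseˡ : ∀ {p} → p ≢ 0ℚ → inv p * p ≡ 1ℚ
inv-inverseˡ {p} p≢0 = trans (*-comm (inv p) p) (inv-inverseʳ p≢0)

*-cancelˡ-≡ : ∀ {p q r} → r ≢ 0ℚ → r * p ≡ r * q → p ≡ q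
*-cancelˡ-≡ {p} {q} {r} r≢0 rp≡rq = begin
  p                ≡⟨ *-identityˡ p ⟨
  1ℚ * p           ≡⟨ cong (_* p) (inv-inverseˡ r≢0) ⟨
  inv r * r * p    ≡⟨ *-assoc (inv r) r p ⟩
  inv r * (r * p)  ≡⟨ cong (inv r *_) rp≡rq ⟩
  inv r * (r * q)  ≡⟨ *-assoc (inv r) r q ⟨
  inv r * r * q    ≡⟨ cong (_* q) (inv-inverseˡ r≢0) ⟩
  1ℚ * q           ≡⟨ *-identityˡ q ⟩
  q                ∎

*-cancelʳ-≡ : ∀ {p q r} → r ≢ 0ℚ → p * r ≡ q * r → p ≡ q
*-cancelʳ-≡ {p} {q} {r} r≢0 pr≡qr =
  *-cancelˡ-≡ r≢0 (trans (*-comm r p) (trans pr≡qr (*-comm q r)))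

p*q≢0 : ∀ {p q} → p ≢ 0ℚ → q ≢ 0ℚ → p * q ≢ 0ℚ
p*q≢0 {p} {q} p≢0 q≢0 pq≡0 = q≢0 (*-cancelˡ-≡ p≢0 (trans pq≡0 (sym (*-zeroʳ p))))

inv-distrib-* : ∀ p q → inv (p * q) ≡ inv p * inv q
inv-distrib-* p q = by-cases (p ≟ 0ℚ) (q ≟ 0ℚ)
  where
  by-cases : Dec (p ≡ 0ℚ) → Dec (q ≡ 0ℚ) → inv (p * q) ≡ inv p * inv q
  by-cases (yes refl) _          = trans (cong inv (*-zeroˡ q)) (sym (*-zeroˡ (inv q)))
  by-cases (no _)     (yes refl) = trans (cong inv (*-zeroʳ p)) (sym (*-zeroʳ (inv p)))
  by-cases (no p≢0)   (no q≢0)   = *-cancelˡ-≡ (p*q≢0 p≢0 q≢0) (begin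
    p * q * inv (p * q)          ≡⟨ inv-inverseʳ (p*q≢0 p≢0 q≢0) ⟩
    1ℚ                           ≡⟨ cong₂ _*_ (inv-inverseʳ p≢0) (inv-inverseʳ q≢0) ⟨
    p * inv p * (q * inv q)      ≡⟨ interchange p (inv p) q (inv q) ⟩
    p * q * (inv p * inv q)      ∎)
    where
    interchange : ∀ w x y z → w * x * (y * z) ≡ w * y * (x * z)
    interchange = solve-∀ ℚ-ring

1-p≢0 : ∀ {p} → p ≢ 1ℚ → 1ℚ - p ≢ 0ℚ
1-p≢0 {p} p≢1 1-p≡0 = p≢1 (begin
  p               ≡⟨ double-negation p ⟩
  1ℚ - (1ℚ - p)   ≡⟨ cong (1ℚ -_) 1-p≡0 ⟩
  1ℚ - 0ℚ         ≡⟨ refl ⟩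
  1ℚ              ∎)
  where
  double-negation : ∀ p → p ≡ 1ℚ - (1ℚ - p)
  double-negation = solve-∀ ℚ-ring

^-distribˡ-+-* : ∀ x m n → x ^ (m ℕ.+ n) ≡ x ^ m * x ^ n
^-distribˡ-+-* x zero    n = sym (*-identityˡ (x ^ n))
^-distribˡ-+-* x (suc m) n = begin
  x * x ^ (m ℕ.+ n)      ≡⟨ cong (x *_) (^-distribˡ-+-* x m n) ⟩
  x * (x ^ m * x ^ n)    ≡⟨ *-assoc x (x ^ m) (x ^ n) ⟨
  x * x ^ m * x ^ n      ∎

^-distribʳ-* : ∀ x y n → (x * y) ^ n ≡ x ^ n * y ^ n
^-distribʳ-* x y zero    = refl
^-distribʳ-* x y (suc n) = begin
  x * y * (x * y) ^ n        ≡⟨ cong (x * y *_) (^-distribʳ-* x y n) ⟩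
  x * y * (x ^ n * y ^ n)    ≡⟨ interchange x y (x ^ n) (y ^ n) ⟩
  x * x ^ n * (y * y ^ n)    ∎
  where
  interchange : ∀ w x y z → w * x * (y * z) ≡ w * y * (x * z)
  interchange = solve-∀ ℚ-ring

^-*-assoc : ∀ x m n → (x ^ m) ^ n ≡ x ^ (m ℕ.* n)
^-*-assoc x m zero    = cong (x ^_) (sym (ℕₚ.*-zeroʳ m))
^-*-assoc x m (suc n) = begin
  x ^ m * (x ^ m) ^ n        ≡⟨ cong (x ^ m *_) (^-*-assoc x m n) ⟩
  x ^ m * x ^ (m ℕ.* n)      ≡⟨ ^-distribˡ-+-* x m (m ℕ.* n) ⟨
  x ^ (m ℕ.+ m ℕ.* n)        ≡⟨ cong (x ^_) (ℕₚ.*-suc m n) ⟨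
  x ^ (m ℕ.* suc n)          ∎

^-≢0 : ∀ {x} → x ≢ 0ℚ → ∀ n → x ^ n ≢ 0ℚ
^-≢0 x≢0 zero    = λ ()
^-≢0 x≢0 (suc n) = p*q≢0 x≢0 (^-≢0 x≢0 n)

0≤p*p : ∀ p → 0ℚ ≤ p * p
0≤p*p p with ≤-total 0ℚ p
... | inj₁ 0≤p = nonNegative⁻¹ (p * p) {{nonNeg*nonNeg⇒nonNeg p {{nonNegative 0≤p}} p {{nonNegative 0≤p}}}}
... | inj₂ p≤0 = subst (_≤ p * p) (*-zeroʳ p) (*-monoˡ-≤-nonPos p {{nonPositive p≤0}} p≤0)

0≤^ : ∀ {x} → 0ℚ ≤ x → ∀ n → 0ℚ ≤ x ^ n
0≤^ 0≤x zero    = nonNegative⁻¹ 1ℚ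
0≤^ {x} 0≤x (suc n) = nonNegative⁻¹ (x * x ^ n)
  {{nonNeg*nonNeg⇒nonNeg x {{nonNegative 0≤x}} (x ^ n) {{nonNegative (0≤^ 0≤x n)}}}}

geometric-sum : ∀ z n → 1ℚ - z ^ n ≡ (1ℚ - z) * sumTo n (z ^_)
geometric-sum z zero    = empty-sum z
  where
  empty-sum : ∀ z → 1ℚ - 1ℚ ≡ (1ℚ - z) * 0ℚ
  empty-sum = solve-∀ ℚ-ring
geometric-sum z (suc n) = begin
  1ℚ - z * z ^ n                                    ≡⟨ split z (z ^ n) ⟩
  (1ℚ - z ^ n) + (1ℚ - z) * z ^ n                   ≡⟨ cong (_+ (1ℚ - z) * z ^ n) (geometric-sum z n) ⟩
  (1ℚ - z) * sumTo n (z ^_) + (1ℚ - z) * z ^ n      ≡⟨ *-distribˡ-+ (1ℚ - z) _ _ ⟨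
  (1ℚ - z) * (sumTo n (z ^_) + z ^ n)               ∎
  where
  split : ∀ z y → 1ℚ - z * y ≡ (1ℚ - y) + (1ℚ - z) * y
  split = solve-∀ ℚ-ring

1≤geometric-sum : ∀ {z} → 0ℚ ≤ z → ∀ n → 1ℚ ≤ sumTo (suc n) (z ^_)
1≤geometric-sum 0≤z zero    = ≤-refl
1≤geometric-sum {z} 0≤z (suc n) =
  subst (_≤ sumTo (suc (suc n)) (z ^_)) (+-identityʳ 1ℚ) (+-mono-≤ (1≤geometric-sum 0≤z n) (0≤^ 0≤z (suc n)))

^-≢1 : ∀ {z} → 0ℚ ≤ z → z ≢ 1ℚ → ∀ n → z ^ suc n ≢ 1ℚ
^-≢1 {z} 0≤z z≢1 n zⁿ⁺¹≡1 = p*q≢0 (1-p≢0 z≢1) sum≢0 (begin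
  (1ℚ - z) * sumTo (suc n) (z ^_)   ≡⟨ geometric-sum z (suc n) ⟨
  1ℚ - z ^ suc n                    ≡⟨ cong (1ℚ -_) zⁿ⁺¹≡1 ⟩
  1ℚ - 1ℚ                           ≡⟨ refl ⟩
  0ℚ                                ∎)
  where
  sum≢0 : sumTo (suc n) (z ^_) ≢ 0ℚ
  sum≢0 sum≡0 = 1≢0 (≤-antisym (subst (1ℚ ≤_) sum≡0 (1≤geometric-sum 0≤z n)) (nonNegative⁻¹ 1ℚ))

^ℤ-pred-* : ∀ {x} → x ≢ 0ℚ → ∀ m → x ^ℤ (+ m -ℤ + 1) * x ≡ x ^ m
^ℤ-pred-* {x} x≢0 zero    =
  trans (cong (inv (x ^ 1) *_) (sym (*-identityʳ x))) (inv-inverseˡ (^-≢0 x≢0 1))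
^ℤ-pred-* {x} x≢0 (suc m) = *-comm (x ^ m) x

^ℤ-distribʳ-* : ∀ x y i → (x * y) ^ℤ i ≡ x ^ℤ i * y ^ℤ i
^ℤ-distribʳ-* x y (+ n)    = ^-distribʳ-* x y n
^ℤ-distribʳ-* x y -[1+ n ] =
  trans (cong inv (^-distribʳ-* x y (suc n))) (inv-distrib-* (x ^ suc n) (y ^ suc n))

qpoch-ratio-step : ∀ a b c k n → 1ℚ - b * c ^ k ≢ 0ℚ →
  (qpoch a c (suc k) ^ n ÷' qpoch b c (suc k) ^ n) * (1ℚ - b * c ^ k) ^ n
    ≡ (qpoch a c k ^ n ÷' qpoch b c k ^ n) * (1ℚ - a * c ^ k) ^ n
qpoch-ratio-step a b c k n v≢0 = begin
  (P * e) ^ n * inv ((Q * v) ^ n) * v ^ n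
    ≡⟨ cong₂ (λ s t → s * inv t * v ^ n) (^-distribʳ-* P e n) (^-distribʳ-* Q v n) ⟩
  P ^ n * e ^ n * inv (Q ^ n * v ^ n) * v ^ n
    ≡⟨ cong (λ t → P ^ n * e ^ n * t * v ^ n) (inv-distrib-* (Q ^ n) (v ^ n)) ⟩
  P ^ n * e ^ n * (inv (Q ^ n) * inv (v ^ n)) * v ^ n
    ≡⟨ regroup (P ^ n) (e ^ n) (inv (Q ^ n)) (inv (v ^ n)) (v ^ n) ⟩
  P ^ n * inv (Q ^ n) * e ^ n * (inv (v ^ n) * v ^ n)
    ≡⟨ cong (P ^ n * inv (Q ^ n) * e ^ n *_) (inv-inverseˡ (^-≢0 v≢0 n)) ⟩
  P ^ n * inv (Q ^ n) * e ^ n * 1ℚ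
    ≡⟨ *-identityʳ _ ⟩
  P ^ n * inv (Q ^ n) * e ^ n
    ∎
  where
  P Q e v : ℚ
  P = qpoch a c k
  Q = qpoch b c k
  e = 1ℚ - a * c ^ k
  v = 1ℚ - b * c ^ k
  regroup : ∀ p e i j v → p * e * (i * j) * v ≡ p * i * e * (j * v)
  regroup = solve-∀ ℚ-ring

-- F and G of the proof idea: clearedRHS q x ρ is (1 - q²)⁶ times the right-hand side
-- and clearedTerm q x ρ is (1 - q²)⁶ times the summand.
rhsNumerator : ℚ → ℚ → ℚ
rhsNumerator q x = q ^ʳ 5 + q ^ʳ 3 * x ^ʳ 2 * (x ^ʳ 2 - q ^ʳ 2 - 1ℚ)

rhsBracket : ℚ → ℚ → ℚ
rhsBracket q x = (1ℚ + 1ℚ) * rhsNumerator q x - (q * x) ^ʳ 2 * (1ℚ - q * q) ^ʳ 2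

clearedRHS : ℚ → ℚ → ℚ → ℚ
clearedRHS q x ρ = (1ℚ - (q * x) ^ʳ 2) ^ʳ 4 * ρ * rhsBracket q x

clearedTerm : ℚ → ℚ → ℚ → ℚ
clearedTerm q x ρ =
  (1ℚ - q * q) ^ʳ 3 * (1ℚ + q) ^ʳ 2 * (1ℚ - q ^ʳ 2 * x ^ʳ 4) * (1ℚ - q * x ^ʳ 2) ^ʳ 2 * ρ * (q * x) ^ʳ 2

clearedRHS-telescopes : ∀ {q x ρ ρ′} → ρ′ * (1ℚ - q ^ʳ 6 * x ^ʳ 2) ^ʳ 4 ≡ ρ * (1ℚ - x ^ʳ 2) ^ʳ 4 →
  clearedRHS q (q * q * x) ρ′ ≡ clearedRHS q x ρ + clearedTerm q x ρ
clearedRHS-telescopes {q} {x} {ρ} {ρ′} step = begin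
  clearedRHS q (q * q * x) ρ′                                ≡⟨ regroup q x ρ′ (rhsBracket q (q * q * x)) ⟩
  ρ′ * (1ℚ - q ^ʳ 6 * x ^ʳ 2) ^ʳ 4 * rhsBracket q (q * q * x) ≡⟨ cong (_* rhsBracket q (q * q * x)) step ⟩
  ρ * (1ℚ - x ^ʳ 2) ^ʳ 4 * rhsBracket q (q * q * x)          ≡⟨ polynomial-identity q x ρ ⟩
  clearedRHS q x ρ + clearedTerm q x ρ                       ∎
  where
  regroup : ∀ q x ρ B → (1ℚ - (q * (q * q * x)) ^ʳ 2) ^ʳ 4 * ρ * B ≡ ρ * (1ℚ - q ^ʳ 6 * x ^ʳ 2) ^ʳ 4 * B
  regroup = solve-∀ ℚ-ring
  polynomial-identity : ∀ q x ρ →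
    ρ * (1ℚ - x ^ʳ 2) ^ʳ 4
      * ((1ℚ + 1ℚ) * (q ^ʳ 5 + q ^ʳ 3 * (q * q * x) ^ʳ 2 * ((q * q * x) ^ʳ 2 - q ^ʳ 2 - 1ℚ))
         - (q * (q * q * x)) ^ʳ 2 * (1ℚ - q * q) ^ʳ 2)
    ≡ (1ℚ - (q * x) ^ʳ 2) ^ʳ 4 * ρ
        * ((1ℚ + 1ℚ) * (q ^ʳ 5 + q ^ʳ 3 * x ^ʳ 2 * (x ^ʳ 2 - q ^ʳ 2 - 1ℚ)) - (q * x) ^ʳ 2 * (1ℚ - q * q) ^ʳ 2)
      + (1ℚ - q * q) ^ʳ 3 * (1ℚ + q) ^ʳ 2 * (1ℚ - q ^ʳ 2 * x ^ʳ 4) * (1ℚ - q * x ^ʳ 2) ^ʳ 2 * ρ * (q * x) ^ʳ 2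
  polynomial-identity = solve-∀ ℚ-ring

clearedRHS-vanishes : ∀ {q x} ρ → q * x ≡ 1ℚ → clearedRHS q x ρ ≡ 0ℚ
clearedRHS-vanishes {q} {x} ρ qx≡1 = begin
  (1ℚ - (q * x) ^ʳ 2) ^ʳ 4 * ρ * rhsBracket q x   ≡⟨ cong (λ y → (1ℚ - y ^ʳ 2) ^ʳ 4 * ρ * rhsBracket q x) qx≡1 ⟩
  (1ℚ - 1ℚ ^ʳ 2) ^ʳ 4 * ρ * rhsBracket q x        ≡⟨ zero-factor ρ (rhsBracket q x) ⟩
  0ℚ                                             ∎
  where
  zero-factor : ∀ ρ B → (1ℚ - 1ℚ ^ʳ 2) ^ʳ 4 * ρ * B ≡ 0ℚ
  zero-factor = solve-∀ ℚ-ring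

rhs-clearing : ∀ {q b} x ρ N → (1ℚ - q * q) * b ≡ 1ℚ →
  (1ℚ - q * q) ^ʳ 6 * ((q * x + 1ℚ) ^ʳ 4 * ((1ℚ - q * x) * b) ^ʳ 4 * ρ
                        * ((1ℚ + 1ℚ) * (N * (b * b)) - (q * x) ^ʳ 2))
    ≡ (1ℚ - (q * x) ^ʳ 2) ^ʳ 4 * ρ * ((1ℚ + 1ℚ) * N - (q * x) ^ʳ 2 * (1ℚ - q * q) ^ʳ 2)
rhs-clearing {q} {b} x ρ N ub≡1 = begin
  (1ℚ - q * q) ^ʳ 6 * ((q * x + 1ℚ) ^ʳ 4 * ((1ℚ - q * x) * b) ^ʳ 4 * ρ
                       * ((1ℚ + 1ℚ) * (N * (b * b)) - (q * x) ^ʳ 2))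
    ≡⟨ regroup q b x ρ N ⟩
  with-unit ((1ℚ - q * q) * b)
    ≡⟨ cong with-unit ub≡1 ⟩
  with-unit 1ℚ
    ≡⟨ drop-unit q x ρ N ⟩
  (1ℚ - (q * x) ^ʳ 2) ^ʳ 4 * ρ * ((1ℚ + 1ℚ) * N - (q * x) ^ʳ 2 * (1ℚ - q * q) ^ʳ 2)
    ∎
  where
  with-unit : ℚ → ℚ
  with-unit β =
    β ^ʳ 4 * ((1ℚ - (q * x) ^ʳ 2) ^ʳ 4 * ρ * ((1ℚ + 1ℚ) * N * β ^ʳ 2 - (q * x) ^ʳ 2 * (1ℚ - q * q) ^ʳ 2))
  regroup : ∀ q b x ρ N →
    (1ℚ - q * q) ^ʳ 6 * ((q * x + 1ℚ) ^ʳ 4 * ((1ℚ - q * x) * b) ^ʳ 4 * ρ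
                         * ((1ℚ + 1ℚ) * (N * (b * b)) - (q * x) ^ʳ 2))
      ≡ ((1ℚ - q * q) * b) ^ʳ 4 * ((1ℚ - (q * x) ^ʳ 2) ^ʳ 4 * ρ
          * ((1ℚ + 1ℚ) * N * ((1ℚ - q * q) * b) ^ʳ 2 - (q * x) ^ʳ 2 * (1ℚ - q * q) ^ʳ 2))
  regroup = solve-∀ ℚ-ring
  drop-unit : ∀ q x ρ N →
    1ℚ ^ʳ 4 * ((1ℚ - (q * x) ^ʳ 2) ^ʳ 4 * ρ * ((1ℚ + 1ℚ) * N * 1ℚ ^ʳ 2 - (q * x) ^ʳ 2 * (1ℚ - q * q) ^ʳ 2))
      ≡ (1ℚ - (q * x) ^ʳ 2) ^ʳ 4 * ρ * ((1ℚ + 1ℚ) * N - (q * x) ^ʳ 2 * (1ℚ - q * q) ^ʳ 2)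
  drop-unit = solve-∀ ℚ-ring

term-clearing : ∀ {q a b} x ρ → (1ℚ - q) * a ≡ 1ℚ → (1ℚ - q * q) * b ≡ 1ℚ →
  (1ℚ - q * q) ^ʳ 6 * ((1ℚ - q ^ʳ 2 * x ^ʳ 4) * b * ((1ℚ - q * x ^ʳ 2) * a) ^ʳ 2 * ρ * (q * x) ^ʳ 2)
    ≡ clearedTerm q x ρ
term-clearing {q} {a} {b} x ρ [1-q]a≡1 ub≡1 = begin
  (1ℚ - q * q) ^ʳ 6 * ((1ℚ - q ^ʳ 2 * x ^ʳ 4) * b * ((1ℚ - q * x ^ʳ 2) * a) ^ʳ 2 * ρ * (q * x) ^ʳ 2)
    ≡⟨ regroup q a b x ρ ⟩
  (1ℚ - q * q) * b * ((1ℚ - q) * a) ^ʳ 2 * clearedTerm q x ρ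
    ≡⟨ cong₂ (λ β α → β * α ^ʳ 2 * clearedTerm q x ρ) ub≡1 [1-q]a≡1 ⟩
  1ℚ * 1ℚ ^ʳ 2 * clearedTerm q x ρ
    ≡⟨ *-identityˡ (clearedTerm q x ρ) ⟩
  clearedTerm q x ρ
    ∎
  where
  regroup : ∀ q a b x ρ →
    (1ℚ - q * q) ^ʳ 6 * ((1ℚ - q ^ʳ 2 * x ^ʳ 4) * b * ((1ℚ - q * x ^ʳ 2) * a) ^ʳ 2 * ρ * (q * x) ^ʳ 2)
      ≡ (1ℚ - q * q) * b * ((1ℚ - q) * a) ^ʳ 2
        * ((1ℚ - q * q) ^ʳ 3 * (1ℚ + q) ^ʳ 2 * (1ℚ - q ^ʳ 2 * x ^ʳ 4) * (1ℚ - q * x ^ʳ 2) ^ʳ 2 * ρ * (q * x) ^ʳ 2)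
  regroup = solve-∀ ℚ-ring

module _ (q : ℚ) where

  u b a : ℚ
  u = 1ℚ - q * q
  b = inv u
  a = inv (1ℚ - q)

  x : ℕ → ℚ
  x k = inv q * (q * q) ^ k

  ρ : ℕ → ℚ
  ρ k = qpoch (q ^ℤ (-ℤ (+ 2))) (q ^ 4) k ^ 4 ÷' qpoch (q ^ 4) (q ^ 4) k ^ 4

  summand : ℕ → ℚ
  summand k =
    qint (q * q) ((+ 4) *ℤ (+ k) -ℤ (+ 1))
    * qint q ((+ 4) *ℤ (+ k) -ℤ (+ 1)) ^ 2
    * (qpoch (q ^ℤ (-ℤ (+ 2))) (q ^ 4) k ^ 4 ÷' qpoch (q ^ 4) (q ^ 4) k ^ 4)
    * q ^ (4 ℕ.* k)

  rhs : ℕ → ℚ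
  rhs n =
    (q ^ (2 ℕ.* n) + 1ℚ) ^ 4 * qint (q * q) (+ n) ^ 4
    * (qpoch (q ^ℤ (-ℤ (+ 2))) (q ^ 4) n ^ 4 ÷' qpoch (q ^ 4) (q ^ 4) n ^ 4)
    * ((1ℚ + 1ℚ) * ((q ^ 5 + q ^ (4 ℕ.* n ℕ.+ 1) * (q ^ (4 ℕ.* n ℕ.∸ 2) - q ^ 2 - 1ℚ)) ÷' (q ^ 2 - 1ℚ) ^ 2)
       - q ^ (4 ℕ.* n))

  module _ (q≢0 : q ≢ 0ℚ) (q²≢1 : q * q ≢ 1ℚ) where

    u≢0 : u ≢ 0ℚ
    u≢0 = 1-p≢0 q²≢1

    ub≡1 : u * b ≡ 1ℚ
    ub≡1 = inv-inverseʳ u≢0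

    [1-q]a≡1 : (1ℚ - q) * a ≡ 1ℚ
    [1-q]a≡1 = inv-inverseʳ (1-p≢0 {q} λ q≡1 → q²≢1 (cong (λ y → y * y) q≡1))

    inv[q²-1]²≡b² : inv ((q ^ 2 - 1ℚ) ^ 2) ≡ b * b
    inv[q²-1]²≡b² = trans (cong inv [q²-1]²≡u²) (inv-distrib-* u u)
      where
      regroup : ∀ q → (q ^ʳ 2 - 1ℚ) ^ʳ 2 ≡ (1ℚ - q * q) * (1ℚ - q * q)
      regroup = solve-∀ ℚ-ring
      [q²-1]²≡u² : (q ^ 2 - 1ℚ) ^ 2 ≡ u * u
      [q²-1]²≡u² = begin
        (q ^ 2 - 1ℚ) ^ 2     ≡⟨ ^≡^ʳ (q ^ 2 - 1ℚ) 2 ⟩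
        (q ^ 2 - 1ℚ) ^ʳ 2    ≡⟨ cong (λ y → (y - 1ℚ) ^ʳ 2) (^≡^ʳ q 2) ⟩
        (q ^ʳ 2 - 1ℚ) ^ʳ 2   ≡⟨ regroup q ⟩
        u * u                ∎

    qx≡[q²]^ : ∀ k → q * x k ≡ (q * q) ^ k
    qx≡[q²]^ k = begin
      q * (inv q * (q * q) ^ k)     ≡⟨ *-assoc q (inv q) _ ⟨
      q * inv q * (q * q) ^ k       ≡⟨ cong (_* (q * q) ^ k) (inv-inverseʳ q≢0) ⟩
      1ℚ * (q * q) ^ k              ≡⟨ *-identityˡ _ ⟩
      (q * q) ^ k                   ∎

    x-suc : ∀ k → x (suc k) ≡ q * q * x k
    x-suc k = swap (inv q) (q * q) ((q * q) ^ k)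
      where
      swap : ∀ i y s → i * (y * s) ≡ y * (i * s)
      swap = solve-∀ ℚ-ring

    [q⁴]^≡[qx]² : ∀ k → (q ^ 4) ^ k ≡ (q * x k) ^ʳ 2
    [q⁴]^≡[qx]² k = begin
      (q ^ 4) ^ k                       ≡⟨ cong (_^ k) (trans (^≡^ʳ q 4) (fourth-power q)) ⟩
      (q * q * (q * q)) ^ k             ≡⟨ ^-distribʳ-* (q * q) (q * q) k ⟩
      (q * q) ^ k * (q * q) ^ k         ≡⟨ cong₂ _*_ (qx≡[q²]^ k) (qx≡[q²]^ k) ⟨
      q * x k * (q * x k)               ≡⟨ square (q * x k) ⟩
      (q * x k) ^ʳ 2                    ∎
      where
      fourth-power : ∀ q → q ^ʳ 4 ≡ q * q * (q * q)
      fourth-power = solve-∀ ℚ-ring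
      square : ∀ y → y * y ≡ y ^ʳ 2
      square = solve-∀ ℚ-ring

    q^4k≡[qx]² : ∀ k → q ^ (4 ℕ.* k) ≡ (q * x k) ^ʳ 2
    q^4k≡[qx]² k = trans (sym (^-*-assoc q 4 k)) ([q⁴]^≡[qx]² k)

    q^ℤ[4k-1]≡qx² : ∀ k → q ^ℤ ((+ 4) *ℤ (+ k) -ℤ (+ 1)) ≡ q * x k ^ʳ 2
    q^ℤ[4k-1]≡qx² k = *-cancelʳ-≡ q≢0 (begin
      q ^ℤ ((+ 4) *ℤ (+ k) -ℤ (+ 1)) * q    ≡⟨ cong (λ i → q ^ℤ (i -ℤ + 1) * q) (sym (pos-* 4 k)) ⟩
      q ^ℤ (+ (4 ℕ.* k) -ℤ (+ 1)) * q       ≡⟨ ^ℤ-pred-* q≢0 (4 ℕ.* k) ⟩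
      q ^ (4 ℕ.* k)                         ≡⟨ q^4k≡[qx]² k ⟩
      (q * x k) ^ʳ 2                        ≡⟨ regroup q (x k) ⟩
      q * x k ^ʳ 2 * q                      ∎)
      where
      regroup : ∀ q x → (q * x) ^ʳ 2 ≡ q * x ^ʳ 2 * q
      regroup = solve-∀ ℚ-ring

    [q²]^ℤ[4k-1]≡q²x⁴ : ∀ k → (q * q) ^ℤ ((+ 4) *ℤ (+ k) -ℤ (+ 1)) ≡ q ^ʳ 2 * x k ^ʳ 4
    [q²]^ℤ[4k-1]≡q²x⁴ k = begin
      (q * q) ^ℤ e                    ≡⟨ ^ℤ-distribʳ-* q q e ⟩
      q ^ℤ e * q ^ℤ e                 ≡⟨ cong₂ _*_ (q^ℤ[4k-1]≡qx² k) (q^ℤ[4k-1]≡qx² k) ⟩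
      q * x k ^ʳ 2 * (q * x k ^ʳ 2)   ≡⟨ regroup q (x k) ⟩
      q ^ʳ 2 * x k ^ʳ 4               ∎
      where
      e = (+ 4) *ℤ (+ k) -ℤ (+ 1)
      regroup : ∀ q x → q * x ^ʳ 2 * (q * x ^ʳ 2) ≡ q ^ʳ 2 * x ^ʳ 4
      regroup = solve-∀ ℚ-ring

    q⁴≡[q²]² : q ^ 4 ≡ (q * q) ^ 2
    q⁴≡[q²]² = trans (^≡^ʳ q 4) (trans (regroup q) (sym (^≡^ʳ (q * q) 2)))
      where
      regroup : ∀ q → q ^ʳ 4 ≡ (q * q) ^ʳ 2
      regroup = solve-∀ ℚ-ring

    [q⁴]^suc≢1 : ∀ k → (q ^ 4) ^ suc k ≢ 1ℚ
    [q⁴]^suc≢1 = ^-≢1 (subst (0ℚ ≤_) (sym q⁴≡[q²]²) (0≤^ (0≤p*p q) 2))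
                      (subst (_≢ 1ℚ) (sym q⁴≡[q²]²) (^-≢1 (0≤p*p q) q²≢1 1))

    ρ-step : ∀ k → ρ (suc k) * (1ℚ - q ^ʳ 6 * x k ^ʳ 2) ^ʳ 4 ≡ ρ k * (1ℚ - x k ^ʳ 2) ^ʳ 4
    ρ-step k = begin
      ρ (suc k) * (1ℚ - q ^ʳ 6 * x k ^ʳ 2) ^ʳ 4   ≡⟨ cong (λ y → ρ (suc k) * (1ℚ - y) ^ʳ 4) q⁴[q⁴]^≡q⁶x² ⟨
      ρ (suc k) * (1ℚ - (q ^ 4) ^ suc k) ^ʳ 4     ≡⟨ cong (ρ (suc k) *_) (^≡^ʳ (1ℚ - (q ^ 4) ^ suc k) 4) ⟨
      ρ (suc k) * (1ℚ - (q ^ 4) ^ suc k) ^ 4      ≡⟨ qpoch-ratio-step q⁻² (q ^ 4) (q ^ 4) k 4 (1-p≢0 ([q⁴]^suc≢1 k)) ⟩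
      ρ k * (1ℚ - q⁻² * (q ^ 4) ^ k) ^ 4          ≡⟨ cong (ρ k *_) (^≡^ʳ (1ℚ - q⁻² * (q ^ 4) ^ k) 4) ⟩
      ρ k * (1ℚ - q⁻² * (q ^ 4) ^ k) ^ʳ 4         ≡⟨ cong (λ y → ρ k * (1ℚ - y) ^ʳ 4) q⁻²[q⁴]^≡x² ⟩
      ρ k * (1ℚ - x k ^ʳ 2) ^ʳ 4                  ∎
      where
      q⁻² = q ^ℤ (-ℤ (+ 2))

      q⁴[q⁴]^≡q⁶x² : q ^ 4 * (q ^ 4) ^ k ≡ q ^ʳ 6 * x k ^ʳ 2
      q⁴[q⁴]^≡q⁶x² = trans (cong₂ _*_ (^≡^ʳ q 4) ([q⁴]^≡[qx]² k)) (regroup q (x k))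
        where
        regroup : ∀ q x → q ^ʳ 4 * (q * x) ^ʳ 2 ≡ q ^ʳ 6 * x ^ʳ 2
        regroup = solve-∀ ℚ-ring

      q⁻²[q⁴]^≡x² : q⁻² * (q ^ 4) ^ k ≡ x k ^ʳ 2
      q⁻²[q⁴]^≡x² = begin
        inv (q ^ 2) * (q ^ 4) ^ k         ≡⟨ cong (inv (q ^ 2) *_) ([q⁴]^≡[qx]² k) ⟩
        inv (q ^ 2) * (q * x k) ^ʳ 2      ≡⟨ regroup (inv (q ^ 2)) q (x k) ⟩
        inv (q ^ 2) * q ^ʳ 2 * x k ^ʳ 2   ≡⟨ cong (λ y → inv (q ^ 2) * y * x k ^ʳ 2) (^≡^ʳ q 2) ⟨
        inv (q ^ 2) * q ^ 2 * x k ^ʳ 2    ≡⟨ cong (_* x k ^ʳ 2) (inv-inverseˡ (^-≢0 q≢0 2)) ⟩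
        1ℚ * x k ^ʳ 2                     ≡⟨ *-identityˡ _ ⟩
        x k ^ʳ 2                          ∎
        where
        regroup : ∀ i q x → i * (q * x) ^ʳ 2 ≡ i * q ^ʳ 2 * x ^ʳ 2
        regroup = solve-∀ ℚ-ring

    summand-cleared : ∀ k → u ^ʳ 6 * summand k ≡ clearedTerm q (x k) (ρ k)
    summand-cleared k = trans (cong (u ^ʳ 6 *_) summand-in-x) (term-clearing {q} (x k) (ρ k) [1-q]a≡1 ub≡1)
      where
      e = (+ 4) *ℤ (+ k) -ℤ (+ 1)
      summand-in-x : summand k ≡ (1ℚ - q ^ʳ 2 * x k ^ʳ 4) * b * ((1ℚ - q * x k ^ʳ 2) * a) ^ʳ 2 * ρ k * (q * x k) ^ʳ 2
      summand-in-x = begin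
        qint (q * q) e * qint q e ^ 2 * ρ k * q ^ (4 ℕ.* k)
          ≡⟨ cong (λ t → qint (q * q) e * t * ρ k * q ^ (4 ℕ.* k)) (^≡^ʳ (qint q e) 2) ⟩
        qint (q * q) e * qint q e ^ʳ 2 * ρ k * q ^ (4 ℕ.* k)
          ≡⟨ cong₂ (λ y z → (1ℚ - y) * b * ((1ℚ - z) * a) ^ʳ 2 * ρ k * q ^ (4 ℕ.* k))
                   ([q²]^ℤ[4k-1]≡q²x⁴ k) (q^ℤ[4k-1]≡qx² k) ⟩
        (1ℚ - q ^ʳ 2 * x k ^ʳ 4) * b * ((1ℚ - q * x k ^ʳ 2) * a) ^ʳ 2 * ρ k * q ^ (4 ℕ.* k)
          ≡⟨ cong ((1ℚ - q ^ʳ 2 * x k ^ʳ 4) * b * ((1ℚ - q * x k ^ʳ 2) * a) ^ʳ 2 * ρ k *_) (q^4k≡[qx]² k) ⟩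
        (1ℚ - q ^ʳ 2 * x k ^ʳ 4) * b * ((1ℚ - q * x k ^ʳ 2) * a) ^ʳ 2 * ρ k * (q * x k) ^ʳ 2
          ∎

    q^2n≡qx : ∀ n → q ^ (2 ℕ.* n) ≡ q * x n
    q^2n≡qx n = begin
      q ^ (2 ℕ.* n)   ≡⟨ ^-*-assoc q 2 n ⟨
      (q ^ 2) ^ n     ≡⟨ cong (λ y → (q * y) ^ n) (*-identityʳ q) ⟩
      (q * q) ^ n     ≡⟨ qx≡[q²]^ n ⟨
      q * x n         ∎

    q^[4n+1]≡q³x² : ∀ n → q ^ (4 ℕ.* n ℕ.+ 1) ≡ q ^ʳ 3 * x n ^ʳ 2
    q^[4n+1]≡q³x² n = begin
      q ^ (4 ℕ.* n ℕ.+ 1)      ≡⟨ ^-distribˡ-+-* q (4 ℕ.* n) 1 ⟩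
      q ^ (4 ℕ.* n) * q ^ 1    ≡⟨ cong₂ _*_ (q^4k≡[qx]² n) (^≡^ʳ q 1) ⟩
      (q * x n) ^ʳ 2 * q ^ʳ 1  ≡⟨ regroup q (x n) ⟩
      q ^ʳ 3 * x n ^ʳ 2        ∎
      where
      regroup : ∀ q x → (q * x) ^ʳ 2 * q ^ʳ 1 ≡ q ^ʳ 3 * x ^ʳ 2
      regroup = solve-∀ ℚ-ring

    -- Stated for n = suc m only: at n = 0 the natural-number exponent 4n ∸ 2 truncates to 0.
    q^[4n∸2]≡x² : ∀ m → q ^ (4 ℕ.* suc m ℕ.∸ 2) ≡ x (suc m) ^ʳ 2
    q^[4n∸2]≡x² m = *-cancelˡ-≡ (^-≢0 q≢0 2) (begin
      q ^ 2 * q ^ (4 ℕ.* n ℕ.∸ 2)      ≡⟨ ^-distribˡ-+-* q 2 (4 ℕ.* n ℕ.∸ 2) ⟨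
      q ^ (2 ℕ.+ (4 ℕ.* n ℕ.∸ 2))      ≡⟨ cong (q ^_) (ℕₚ.m+[n∸m]≡n 2≤4n) ⟩
      q ^ (4 ℕ.* n)                    ≡⟨ q^4k≡[qx]² n ⟩
      (q * x n) ^ʳ 2                   ≡⟨ regroup q (x n) ⟩
      q ^ʳ 2 * x n ^ʳ 2                ≡⟨ cong (_* x n ^ʳ 2) (^≡^ʳ q 2) ⟨
      q ^ 2 * x n ^ʳ 2                 ∎)
      where
      n = suc m
      2≤4n : 2 ℕ.≤ 4 ℕ.* n
      2≤4n = ℕₚ.≤-trans (ℕₚ.m≤m+n 2 2) (ℕₚ.m≤m*n 4 n)
      regroup : ∀ q x → (q * x) ^ʳ 2 ≡ q ^ʳ 2 * x ^ʳ 2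
      regroup = solve-∀ ℚ-ring

    rhs-cleared : ∀ m → u ^ʳ 6 * rhs (suc m) ≡ clearedRHS q (x (suc m)) (ρ (suc m))
    rhs-cleared m =
      trans (cong (u ^ʳ 6 *_) rhs-in-x) (rhs-clearing {q} (x n) (ρ n) (rhsNumerator q (x n)) ub≡1)
      where
      n = suc m
      shape : ℚ → ℚ → ℚ → ℚ → ℚ → ℚ → ℚ → ℚ → ℚ
      shape A B p₅ p₂ y z v w = A * B * ρ n * ((1ℚ + 1ℚ) * ((p₅ + y * (z - p₂ - 1ℚ)) * v) - w)
      A B : ℚ
      A = (q * x n + 1ℚ) ^ʳ 4
      B = ((1ℚ - q * x n) * b) ^ʳ 4
      rhs-in-x : rhs n ≡ shape A B (q ^ʳ 5) (q ^ʳ 2) (q ^ʳ 3 * x n ^ʳ 2) (x n ^ʳ 2) (b * b) ((q * x n) ^ʳ 2)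
      rhs-in-x = begin
        shape ((q ^ (2 ℕ.* n) + 1ℚ) ^ 4) (((1ℚ - (q * q) ^ n) * b) ^ 4) (q ^ 5) (q ^ 2)
              (q ^ (4 ℕ.* n ℕ.+ 1)) (q ^ (4 ℕ.* n ℕ.∸ 2)) (inv ((q ^ 2 - 1ℚ) ^ 2)) (q ^ (4 ℕ.* n))
          ≡⟨ cong₂ (λ A′ B′ → shape A′ B′ (q ^ 5) (q ^ 2) (q ^ (4 ℕ.* n ℕ.+ 1)) (q ^ (4 ℕ.* n ℕ.∸ 2))
                                        (inv ((q ^ 2 - 1ℚ) ^ 2)) (q ^ (4 ℕ.* n)))
                   (trans (^≡^ʳ (q ^ (2 ℕ.* n) + 1ℚ) 4) (cong (λ s → (s + 1ℚ) ^ʳ 4) (q^2n≡qx n)))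
                   (trans (^≡^ʳ ((1ℚ - (q * q) ^ n) * b) 4) (cong (λ t → ((1ℚ - t) * b) ^ʳ 4) (sym (qx≡[q²]^ n)))) ⟩
        shape A B (q ^ 5) (q ^ 2)
              (q ^ (4 ℕ.* n ℕ.+ 1)) (q ^ (4 ℕ.* n ℕ.∸ 2)) (inv ((q ^ 2 - 1ℚ) ^ 2)) (q ^ (4 ℕ.* n))
          ≡⟨ cong₂ (λ p₅ p₂ → shape A B p₅ p₂ (q ^ (4 ℕ.* n ℕ.+ 1)) (q ^ (4 ℕ.* n ℕ.∸ 2))
                                      (inv ((q ^ 2 - 1ℚ) ^ 2)) (q ^ (4 ℕ.* n)))
                   (^≡^ʳ q 5) (^≡^ʳ q 2) ⟩
        shape A B (q ^ʳ 5) (q ^ʳ 2)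
              (q ^ (4 ℕ.* n ℕ.+ 1)) (q ^ (4 ℕ.* n ℕ.∸ 2)) (inv ((q ^ 2 - 1ℚ) ^ 2)) (q ^ (4 ℕ.* n))
          ≡⟨ cong₂ (λ y z → shape A B (q ^ʳ 5) (q ^ʳ 2) y z (inv ((q ^ 2 - 1ℚ) ^ 2)) (q ^ (4 ℕ.* n)))
                   (q^[4n+1]≡q³x² n) (q^[4n∸2]≡x² m) ⟩
        shape A B (q ^ʳ 5) (q ^ʳ 2)
              (q ^ʳ 3 * x n ^ʳ 2) (x n ^ʳ 2) (inv ((q ^ 2 - 1ℚ) ^ 2)) (q ^ (4 ℕ.* n))
          ≡⟨ cong₂ (shape A B (q ^ʳ 5) (q ^ʳ 2) (q ^ʳ 3 * x n ^ʳ 2) (x n ^ʳ 2))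
                   inv[q²-1]²≡b² (q^4k≡[qx]² n) ⟩
        shape A B (q ^ʳ 5) (q ^ʳ 2) (q ^ʳ 3 * x n ^ʳ 2) (x n ^ʳ 2) (b * b) ((q * x n) ^ʳ 2)
          ∎

    partial-sums-cleared : ∀ n → u ^ʳ 6 * sumTo n summand ≡ clearedRHS q (x n) (ρ n)
    partial-sums-cleared zero    = trans (*-zeroʳ (u ^ʳ 6))
                                         (sym (clearedRHS-vanishes {q} (ρ 0) (qx≡[q²]^ 0)))
    partial-sums-cleared (suc n) = begin
      u ^ʳ 6 * (sumTo n summand + summand n)
        ≡⟨ *-distribˡ-+ (u ^ʳ 6) _ _ ⟩
      u ^ʳ 6 * sumTo n summand + u ^ʳ 6 * summand n
        ≡⟨ cong₂ _+_ (partial-sums-cleared n) (summand-cleared n) ⟩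
      clearedRHS q (x n) (ρ n) + clearedTerm q (x n) (ρ n)
        ≡⟨ clearedRHS-telescopes {q} (ρ-step n) ⟨
      clearedRHS q (q * q * x n) (ρ (suc n))
        ≡⟨ cong (λ y → clearedRHS q y (ρ (suc n))) (x-suc n) ⟨
      clearedRHS q (x (suc n)) (ρ (suc n))
        ∎

    u⁶≢0 : u ^ʳ 6 ≢ 0ℚ
    u⁶≢0 = subst (_≢ 0ℚ) (^≡^ʳ u 6) (^-≢0 u≢0 6)

theorem2p1 : (n : ℕ) → NonZero n → (q : ℚ) → q ≢ 0ℚ → q * q ≢ 1ℚ →
  sumTo n (λ k →
      qint (q * q) ((+ 4) *ℤ (+ k) -ℤ (+ 1))
      * qint q ((+ 4) *ℤ (+ k) -ℤ (+ 1)) ^ 2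
      * (qpoch (q ^ℤ (-ℤ (+ 2))) (q ^ 4) k ^ 4 ÷' qpoch (q ^ 4) (q ^ 4) k ^ 4)
      * q ^ (4 Data.Nat.* k))
  ≡
  (q ^ (2 Data.Nat.* n) + 1ℚ) ^ 4 * qint (q * q) (+ n) ^ 4
    * (qpoch (q ^ℤ (-ℤ (+ 2))) (q ^ 4) n ^ 4 ÷' qpoch (q ^ 4) (q ^ 4) n ^ 4)
    * ((1ℚ + 1ℚ) * ((q ^ 5 + q ^ (4 Data.Nat.* n Data.Nat.+ 1) * (q ^ (4 Data.Nat.* n Data.Nat.∸ 2) - q ^ 2 - 1ℚ)) ÷' (q ^ 2 - 1ℚ) ^ 2)
       - q ^ (4 Data.Nat.* n))
theorem2p1 zero    n≢0 _ _ _          = ⊥-elim (NonZero.nonZero n≢0)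
theorem2p1 (suc m) _   q q≢0 q²≢1 =
  *-cancelˡ-≡ (u⁶≢0 q q≢0 q²≢1)
    (trans (partial-sums-cleared q q≢0 q²≢1 (suc m)) (sym (rhs-cleared q q≢0 q²≢1 m)))
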